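{- Let $\mathbf{a}$ be a $(q_0,q_1)$-fixing random projection from $x_1,\dots,x_{n_a}$ to $y_1,\dots,y_{m_a}$ and $\mathbf{b}$ a $(q_0,q_1)$-fixing random projection from $w_1,\dots,w_{n_b}$ to $z_1,\dots,z_{m_b}$. Then the join $\mathbf{a}\uplus\mathbf{b}$ is a $(q_0,q_1)$-fixing random projection.
   Context: A projection $\pi$ from variables $u_1,\dots,u_n$ to variables $v_1,\dots,v_m$ is a map $\{u_1,\dots,u_n\}\to\{0,1,v_1,\overline{v_1},\dots,v_m,\overline{v_m}\}$; a random projection is a distribution over projections. $\pi_{v_j\gets\sigma}$ is $\pi$ with $v_j$ substituted by $\sigma\in\{0,1\}$, and $\mathrm{var}(\ell)$ is the variable underlying a literal $\ell$. A random projection $\mathbf{p}$ is $(q_0,q_1)$-fixing if for all projections $\pi$, $\sigma\in\{0,1\}$ and input variables $u_i$: $\Pr[\mathbf{p}(u_i)\notin\{0,1\}\text{ and }\mathbf{p}_{\mathrm{var}(\mathbf{p}(u_i))\gets\sigma}=\pi]\le q_\sigma\Pr[\mathbf{p}=\pi]$. The join $\mathbf{a}\uplus\mathbf{b}$ is the random projection from $x_1,\dots,x_{n_a},w_1,\dots,w_{n_b}$ to $y_1,\dots,y_{m_a},z_1,\dots,z_{m_b}$ obtained by sampling $\mathbf{a}$ and $\mathbf{b}$ independently and mapping each $x_i$ to $\mathbf{a}(x_i)$ and each $w_i$ to $\mathbf{b}(w_i)$.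
   Formalization: The probabilities of the random projections $\mathbf{a}$ and $\mathbf{b}$, and the parameters $(q_0,q_1)$, are rational. -}

module Defs where

open import Data.Bool using (Bool; true; false; not; if_then_else_; _∧_)
open import Data.Nat using (ℕ; _+_)
open import Data.Fin using (Fin; splitAt; _↑ˡ_; _↑ʳ_)
open import Data.Fin.Properties as FinP using ()
open import Data.List using (List; []; _∷_; map; concatMap; foldr)
open import Data.Product using (_×_; _,_; proj₁; proj₂)
open import Data.Sum using (inj₁; inj₂)
open import Data.Rational using (ℚ; 0ℚ; 1ℚ) renaming (_+_ to _+ℚ_; _*_ to _*ℚ_; _≤_ to _≤ℚ_)
open import Data.List.Relation.Unary.All using (All)
open import Relation.Binary.PropositionalEquality using (_≡_; refl)
open import Relation.Nullary using (Dec; yes; no; does)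

data Lit (m : ℕ) : Set where
  const : Bool → Lit m
  pos   : Fin m → Lit m
  neg   : Fin m → Lit m

Proj : ℕ → ℕ → Set
Proj n m = Fin n → Lit m

_==L_ : ∀ {m} → Lit m → Lit m → Bool
const a ==L const b = does (a Data.Bool.≟ b)
pos i   ==L pos j   = does (i FinP.≟ j)
neg i   ==L neg j   = does (i FinP.≟ j)
_       ==L _       = false

allFin : ∀ n → (Fin n → Bool) → Bool
allFin ℕ.zero    f = true
allFin (ℕ.suc n) f = f Fin.zero ∧ allFin n (λ i → f (Fin.suc i))

_==P_ : ∀ {n m} → Proj n m → Proj n m → Bool
_==P_ {n} ρ π = allFin n (λ i → ρ i ==L π i)

substLit : ∀ {m} → Fin m → Bool → Lit m → Lit m
substLit j σ (const b) = const b
substLit j σ (pos k) = if does (k FinP.≟ j) then const σ else pos k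
substLit j σ (neg k) = if does (k FinP.≟ j) then const (not σ) else neg k

substP : ∀ {n m} → Proj n m → Fin m → Bool → Proj n m
substP ρ j σ i = substLit j σ (ρ i)

-- A (finitely supported) random projection: a list of weighted projections.
-- Entries may repeat; the probability of a projection is the total weight.
RP : ℕ → ℕ → Set
RP n m = List (ℚ × Proj n m)

sumℚ : List ℚ → ℚ
sumℚ = foldr _+ℚ_ 0ℚ

Pr : ∀ {n m} → RP n m → (Proj n m → Bool) → ℚ
Pr p E = sumℚ (map (λ e → if E (proj₂ e) then proj₁ e else 0ℚ) p)

IsRandomProjection : ∀ {n m} → RP n m → Set
IsRandomProjection p = All (λ e → 0ℚ ≤ℚ proj₁ e) p × sumℚ (map proj₁ p) ≡ 1ℚ

fixEvent : ∀ {n m} → Proj n m → Bool → Fin n → Proj n m → Bool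
fixEvent π σ i ρ with ρ i
... | const _ = false
... | pos j   = substP ρ j σ ==P π
... | neg j   = substP ρ j σ ==P π

qOf : ℚ → ℚ → Bool → ℚ
qOf q₀ q₁ false = q₀
qOf q₀ q₁ true  = q₁

IsFixing : ∀ {n m} → ℚ → ℚ → RP n m → Set
IsFixing {n} {m} q₀ q₁ p =
  (π : Proj n m) (σ : Bool) (i : Fin n) →
  Pr p (fixEvent π σ i) ≤ℚ qOf q₀ q₁ σ *ℚ Pr p (λ ρ → ρ ==P π)

liftL : ∀ {ma} mb → Lit ma → Lit (ma + mb)
liftL mb (const b) = const b
liftL mb (pos j) = pos (j ↑ˡ mb)
liftL mb (neg j) = neg (j ↑ˡ mb)

liftR : ∀ ma {mb} → Lit mb → Lit (ma + mb)
liftR ma (const b) = const b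
liftR ma (pos j) = pos (ma ↑ʳ j)
liftR ma (neg j) = neg (ma ↑ʳ j)

joinP : ∀ {na ma nb mb} → Proj na ma → Proj nb mb → Proj (na + nb) (ma + mb)
joinP {na} {ma} {nb} {mb} α β i with splitAt na i
... | inj₁ k = liftL mb (α k)
... | inj₂ k = liftR ma (β k)

_⊎RP_ : ∀ {na ma nb mb} → RP na ma → RP nb mb → RP (na + nb) (ma + mb)
a ⊎RP b = concatMap (λ ea → map (λ eb → (proj₁ ea *ℚ proj₁ eb , joinP (proj₂ ea) (proj₂ eb))) b) a

-- Both events in the fixing inequality for a ⊎ b factor over the independent pair (a, b).
-- The event "a ⊎ b = π" is "lift a = π|x" ∧ "lift b = π|w". For an input x_i, the variable
-- of a(x_i) is a y-variable, so fixing it only changes the a-half: the fixing event is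
-- "a fixes x_i into {α | lift α = π|x}" ∧ "lift b = π|w". Since lifting is injective, that
-- set is a single projection or empty, so the fixing property of a bounds the first factor
-- by q_σ · Pr[lift a = π|x]; multiplying by Pr[lift b = π|w] ≥ 0 gives the claim. Inputs
-- w_i are symmetric.

module Submission where

open import Defs
open import Data.Nat using (ℕ)
open import Data.Rational using (ℚ)
open import Data.Product using (_×_)

import Data.Nat as ℕ
open import Algebra.Bundles using (CommutativeMonoid)
import Algebra.Properties.CommutativeSemigroup as CommSemigroupProperties
open import Data.Bool using (Bool; true; false; T; _∧_; if_then_else_)
import Data.Bool as Bool
open import Data.Bool.Properties using (∧-assoc; ∧-zeroʳ; T-∧; T-≡; ¬-not)
open import Data.Empty using (⊥-elim)
open import Data.Fin using (Fin; splitAt; _↑ˡ_; _↑ʳ_)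
open import Data.Fin.Properties
  using (_≟_; ↑ˡ-injective; ↑ʳ-injective; splitAt-↑ˡ; splitAt-↑ʳ; splitAt⁻¹-↑ˡ; splitAt⁻¹-↑ʳ; any?; all?)
open import Data.List using ([]; _∷_; map; _++_)
open import Data.List.Relation.Unary.All using (All; []; _∷_)
import Data.List.Relation.Unary.All as All
open import Data.List.Relation.Unary.All.Properties using (concat⁺; map⁺)
open import Data.Maybe using (Maybe; just; nothing; maybe)
open import Data.Product using (∃; _,_; proj₁; proj₂)
open import Data.Rational using (0ℚ; 1ℚ; _+_; _*_; _≤_; nonNegative)
open import Data.Rational.Properties
  using (+-identityˡ; +-assoc; +-mono-≤; ≤-refl; *-zeroˡ; *-zeroʳ; *-identityˡ; *-assoc; *-distribˡ-+; *-distribʳ-+;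
         *-monoʳ-≤-nonNeg; *-monoˡ-≤-nonNeg; nonNeg*nonNeg⇒nonNeg; nonNegative⁻¹; *-1-commutativeMonoid;
         module ≤-Reasoning)
open import Data.Sum using (_⊎_; inj₁; inj₂)
open import Function using (_∘_; _⇔_; mk⇔; Equivalence)
open import Function.Definitions using (Injective)
open import Relation.Binary.PropositionalEquality
open import Relation.Nullary using (Dec; yes; no; does; _because_)
open import Relation.Nullary.Reflects using (invert)
open import Relation.Nullary.Decidable using (dec-true; dec-false)

private
  variable
    n m M : ℕ

T-⇔⇒≡ : ∀ {x y} → (T x → T y) → (T y → T x) → x ≡ y
T-⇔⇒≡ {false} {false} _ _ = refl
T-⇔⇒≡ {false} {true}  _ y⇒x = ⊥-elim (y⇒x _)
T-⇔⇒≡ {true}  {false} x⇒y _ = ⊥-elim (x⇒y _)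
T-⇔⇒≡ {true}  {true}  _ _ = refl

allFin-T : ∀ n {f : Fin n → Bool} → T (allFin n f) ⇔ (∀ i → T (f i))
allFin-T ℕ.zero    = mk⇔ (λ _ ()) _
allFin-T (ℕ.suc n) {f} = mk⇔ to from
  where
  to : T (allFin (ℕ.suc n) f) → ∀ i → T (f i)
  to t Fin.zero    = proj₁ (Equivalence.to T-∧ t)
  to t (Fin.suc i) = Equivalence.to (allFin-T n) (proj₂ (Equivalence.to T-∧ t)) i
  from : (∀ i → T (f i)) → T (allFin (ℕ.suc n) f)
  from h = Equivalence.from T-∧ (h Fin.zero , Equivalence.from (allFin-T n) (λ i → h (Fin.suc i)))

allFin-cong : ∀ n {f g : Fin n → Bool} → (∀ i → f i ≡ g i) → allFin n f ≡ allFin n g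
allFin-cong ℕ.zero    _ = refl
allFin-cong (ℕ.suc n) h = cong₂ _∧_ (h Fin.zero) (allFin-cong n (λ i → h (Fin.suc i)))

allFin-+ : ∀ na nb (f : Fin (na ℕ.+ nb) → Bool) →
  allFin (na ℕ.+ nb) f ≡ allFin na (λ k → f (k ↑ˡ nb)) ∧ allFin nb (λ k → f (na ↑ʳ k))
allFin-+ ℕ.zero     nb f = refl
allFin-+ (ℕ.suc na) nb f = trans (cong (f Fin.zero ∧_) (allFin-+ na nb (λ i → f (Fin.suc i))))
                                 (sym (∧-assoc (f Fin.zero) _ _))

T-does : ∀ {a} {A : Set a} (d : Dec A) → T (does d) → A
T-does (true because [a]) _ = invert [a]

==L-sound : {l l′ : Lit m} → T (l ==L l′) → l ≡ l′
==L-sound {l = const a} {const b} t = cong const (T-does (a Bool.≟ b) t)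
==L-sound {l = pos i}   {pos j}   t = cong pos (T-does (i ≟ j) t)
==L-sound {l = neg i}   {neg j}   t = cong neg (T-does (i ≟ j) t)

==L-refl : (l : Lit m) → T (l ==L l)
==L-refl (const a) = Equivalence.from T-≡ (dec-true (a Bool.≟ a) refl)
==L-refl (pos i)   = Equivalence.from T-≡ (dec-true (i ≟ i) refl)
==L-refl (neg i)   = Equivalence.from T-≡ (dec-true (i ≟ i) refl)

==P⇒≗ : ∀ (ρ π : Proj n m) → T (ρ ==P π) → ρ ≗ π
==P⇒≗ {n} ρ π t i = ==L-sound (Equivalence.to (allFin-T n) t i)

≗⇒==P : ∀ (ρ π : Proj n m) → ρ ≗ π → T (ρ ==P π)
≗⇒==P {n} ρ π ρ≗π =
  Equivalence.from (allFin-T n) λ i → subst (λ l → T (ρ i ==L l)) (ρ≗π i) (==L-refl (ρ i))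

==P-congˡ : {ρ ρ′ : Proj n m} (π : Proj n m) → ρ ≗ ρ′ → (ρ ==P π) ≡ (ρ′ ==P π)
==P-congˡ {n} π ρ≗ρ′ = allFin-cong n (λ i → cong (_==L π i) (ρ≗ρ′ i))

renameLit : (Fin m → Fin M) → Lit m → Lit M
renameLit g (const b) = const b
renameLit g (pos j)   = pos (g j)
renameLit g (neg j)   = neg (g j)

renameP : (Fin m → Fin M) → Proj n m → Proj n M
renameP g α i = renameLit g (α i)

liftL≡renameLit : ∀ mb (l : Lit m) → liftL mb l ≡ renameLit (_↑ˡ mb) l
liftL≡renameLit mb (const b) = refl
liftL≡renameLit mb (pos j)   = refl
liftL≡renameLit mb (neg j)   = refl

liftR≡renameLit : ∀ ma (l : Lit m) → liftR ma l ≡ renameLit (ma ↑ʳ_) l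
liftR≡renameLit ma (const b) = refl
liftR≡renameLit ma (pos j)   = refl
liftR≡renameLit ma (neg j)   = refl

renameLit-injective : {g : Fin m → Fin M} → Injective _≡_ _≡_ g → Injective _≡_ _≡_ (renameLit g)
renameLit-injective g-inj {const a} {const b} refl = refl
renameLit-injective g-inj {pos i}   {pos j}   eq   = cong pos (g-inj (pos-injective eq))
  where pos-injective : ∀ {i j : Fin M} → pos {M} i ≡ pos j → i ≡ j
        pos-injective refl = refl
renameLit-injective g-inj {neg i}   {neg j}   eq   = cong neg (g-inj (neg-injective eq))
  where neg-injective : ∀ {i j : Fin M} → neg {M} i ≡ neg j → i ≡ j
        neg-injective refl = refl

renameLit-image? : (g : Fin m → Fin M) (l′ : Lit M) → Dec (∃ λ l → renameLit g l ≡ l′)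
renameLit-image? g (const b) = yes (const b , refl)
renameLit-image? g (pos j) with any? (λ k → g k ≟ j)
... | yes (k , refl) = yes (pos k , refl)
... | no ∄k          = no λ { (pos k , refl) → ∄k (k , refl) }
renameLit-image? g (neg j) with any? (λ k → g k ≟ j)
... | yes (k , refl) = yes (neg k , refl)
... | no ∄k          = no λ { (neg k , refl) → ∄k (k , refl) }

substLit-renameLit : {g : Fin m → Fin M} → Injective _≡_ _≡_ g → ∀ j σ (l : Lit m) →
  substLit (g j) σ (renameLit g l) ≡ renameLit g (substLit j σ l)
substLit-renameLit g-inj j σ (const b) = refl
substLit-renameLit {g = g} g-inj j σ (pos k) with k ≟ j
... | yes refl rewrite dec-true (g j ≟ g j) refl = refl
... | no k≢j   rewrite dec-false (g k ≟ g j) (k≢j ∘ g-inj) = refl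
substLit-renameLit {g = g} g-inj j σ (neg k) with k ≟ j
... | yes refl rewrite dec-true (g j ≟ g j) refl = refl
... | no k≢j   rewrite dec-false (g k ≟ g j) (k≢j ∘ g-inj) = refl

substLit-renameLit-apart : {h : Fin n → Fin M} (x : Fin M) → (∀ k → h k ≢ x) → ∀ σ l →
  substLit x σ (renameLit h l) ≡ renameLit h l
substLit-renameLit-apart x apart σ (const b) = refl
substLit-renameLit-apart {h = h} x apart σ (pos k) rewrite dec-false (h k ≟ x) (apart k) = refl
substLit-renameLit-apart {h = h} x apart σ (neg k) rewrite dec-false (h k ≟ x) (apart k) = refl

AtMostPoint : (Proj n m → Bool) → Set
AtMostPoint M = (∃ λ α₀ → ∀ α → M α ≡ (α ==P α₀)) ⊎ (∀ α → M α ≡ false)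

renameP-atMostPoint : {g : Fin m → Fin M} → Injective _≡_ _≡_ g → (f : Proj n M) →
  AtMostPoint (λ (α : Proj n m) → renameP g α ==P f)
renameP-atMostPoint {g = g} g-inj f with all? (λ k → renameLit-image? g (f k))
... | yes preimage = inj₁ (α₀ , λ α → T-⇔⇒≡ (to α) (from α))
  where
  α₀ : Proj _ _
  α₀ k = proj₁ (preimage k)
  to : ∀ α → T (renameP g α ==P f) → T (α ==P α₀)
  to α t = ≗⇒==P α α₀ λ k →
    renameLit-injective g-inj (trans (==P⇒≗ (renameP g α) f t k) (sym (proj₂ (preimage k))))
  from : ∀ α → T (α ==P α₀) → T (renameP g α ==P f)
  from α t = ≗⇒==P (renameP g α) f λ k →
    trans (cong (renameLit g) (==P⇒≗ α α₀ t k)) (proj₂ (preimage k))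
... | no ∄preimage = inj₂ λ α → ¬-not λ matches →
  ∄preimage λ k → α k , ==P⇒≗ (renameP g α) f (Equivalence.from T-≡ matches) k

var : Lit m → Maybe (Fin m)
var (const _) = nothing
var (pos j)   = just j
var (neg j)   = just j

fixesInto : (Proj n m → Bool) → Bool → Fin n → Proj n m → Bool
fixesInto M σ i ρ = maybe (λ j → M (substP ρ j σ)) false (var (ρ i))

fixEvent≡fixesInto : ∀ (π : Proj n m) σ i ρ → fixEvent π σ i ρ ≡ fixesInto (_==P π) σ i ρ
fixEvent≡fixesInto π σ i ρ with ρ i
... | const _ = refl
... | pos j   = refl
... | neg j   = refl

fixesInto-cong : {M M′ : Proj n m → Bool} → (∀ ρ → M ρ ≡ M′ ρ) → ∀ σ i ρ →
  fixesInto M σ i ρ ≡ fixesInto M′ σ i ρ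
fixesInto-cong M≗M′ σ i ρ with var (ρ i)
... | just j  = M≗M′ (substP ρ j σ)
... | nothing = refl

fixesInto-never : {M : Proj n m → Bool} → (∀ ρ → M ρ ≡ false) → ∀ σ i ρ →
  fixesInto M σ i ρ ≡ false
fixesInto-never never σ i ρ with var (ρ i)
... | just j  = never (substP ρ j σ)
... | nothing = refl

NonNegWeights : RP n m → Set
NonNegWeights p = All (λ e → 0ℚ ≤ proj₁ e) p

Pr-cong : (p : RP n m) {E E′ : Proj n m → Bool} → (∀ ρ → E ρ ≡ E′ ρ) → Pr p E ≡ Pr p E′
Pr-cong []            E≗E′ = refl
Pr-cong ((w , ρ) ∷ p) E≗E′ = cong₂ _+_ (cong (if_then w else 0ℚ) (E≗E′ ρ)) (Pr-cong p E≗E′)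

Pr-never : (p : RP n m) {E : Proj n m → Bool} → (∀ ρ → E ρ ≡ false) → Pr p E ≡ 0ℚ
Pr-never []            never = refl
Pr-never ((w , ρ) ∷ p) never rewrite never ρ | Pr-never p never = +-identityˡ 0ℚ

Pr-++ : (p p′ : RP n m) (E : Proj n m → Bool) → Pr (p ++ p′) E ≡ Pr p E + Pr p′ E
Pr-++ []            p′ E = sym (+-identityˡ (Pr p′ E))
Pr-++ ((w , ρ) ∷ p) p′ E = trans (cong (x +_) (Pr-++ p p′ E)) (sym (+-assoc x (Pr p E) (Pr p′ E)))
  where x = if E ρ then w else 0ℚ

Pr-nonNeg : (p : RP n m) (E : Proj n m → Bool) → NonNegWeights p → 0ℚ ≤ Pr p E
Pr-nonNeg []            E []        = ≤-refl
Pr-nonNeg ((w , ρ) ∷ p) E (0≤w ∷ ws) with E ρ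
... | true  = subst (_≤ w + Pr p E) (+-identityˡ 0ℚ) (+-mono-≤ 0≤w (Pr-nonNeg p E ws))
... | false = subst (_≤ 0ℚ + Pr p E) (+-identityˡ 0ℚ) (+-mono-≤ ≤-refl (Pr-nonNeg p E ws))

fixesInto-bound : ∀ {q₀ q₁} {p : RP n m} {M : Proj n m → Bool} → IsFixing q₀ q₁ p → AtMostPoint M →
  ∀ σ i → Pr p (fixesInto M σ i) ≤ qOf q₀ q₁ σ * Pr p M
fixesInto-bound {q₀ = q₀} {q₁} {p} {M} fixing (inj₁ (α₀ , M≗α₀)) σ i =
  subst₂ (λ x y → x ≤ qOf q₀ q₁ σ * y) (sym fixesInto≡fixEvent) (sym (Pr-cong p M≗α₀)) (fixing α₀ σ i)
  where
  fixesInto≡fixEvent : Pr p (fixesInto M σ i) ≡ Pr p (fixEvent α₀ σ i)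
  fixesInto≡fixEvent = Pr-cong p λ ρ →
    trans (fixesInto-cong M≗α₀ σ i ρ) (sym (fixEvent≡fixesInto α₀ σ i ρ))
fixesInto-bound {q₀ = q₀} {q₁} {p} fixing (inj₂ never) σ i
  rewrite Pr-never p (fixesInto-never never σ i) | Pr-never p never | *-zeroʳ (qOf q₀ q₁ σ) = ≤-refl

↑ˡ≢↑ʳ : ∀ {m n} (i : Fin m) (j : Fin n) → i ↑ˡ n ≢ m ↑ʳ j
↑ˡ≢↑ʳ {m} {n} i j eq
  with () ← trans (sym (splitAt-↑ˡ m i n)) (trans (cong (splitAt m) eq) (splitAt-↑ʳ m n j))

if-∧-* : ∀ x y (u v : ℚ) →
  (if x ∧ y then u * v else 0ℚ) ≡ (if x then u else 0ℚ) * (if y then v else 0ℚ)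
if-∧-* true  true  u v = refl
if-∧-* true  false u v = sym (*-zeroʳ u)
if-∧-* false true  u v = sym (*-zeroˡ v)
if-∧-* false false u v = sym (*-zeroˡ 0ℚ)

*-nonNeg : ∀ {u v} → 0ℚ ≤ u → 0ℚ ≤ v → 0ℚ ≤ u * v
*-nonNeg {u} {v} 0≤u 0≤v =
  nonNegative⁻¹ (u * v) {{nonNeg*nonNeg⇒nonNeg u {{nonNegative 0≤u}} v {{nonNegative 0≤v}}}}

module _ {na ma nb mb : ℕ} where

  joinP-↑ˡ : (α : Proj na ma) (β : Proj nb mb) (k : Fin na) →
    joinP α β (k ↑ˡ nb) ≡ renameLit (_↑ˡ mb) (α k)
  joinP-↑ˡ α β k rewrite splitAt-↑ˡ na k nb = liftL≡renameLit mb (α k)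

  joinP-↑ʳ : (α : Proj na ma) (β : Proj nb mb) (k : Fin nb) →
    joinP α β (na ↑ʳ k) ≡ renameLit (ma ↑ʳ_) (β k)
  joinP-↑ʳ α β k rewrite splitAt-↑ʳ na nb k = liftR≡renameLit ma (β k)

  matchesˡ : Proj (na ℕ.+ nb) (ma ℕ.+ mb) → Proj na ma → Bool
  matchesˡ π α = renameP (_↑ˡ mb) α ==P (λ k → π (k ↑ˡ nb))

  matchesʳ : Proj (na ℕ.+ nb) (ma ℕ.+ mb) → Proj nb mb → Bool
  matchesʳ π β = renameP (ma ↑ʳ_) β ==P (λ k → π (na ↑ʳ k))

  ==P-joinP : ∀ π (α : Proj na ma) (β : Proj nb mb) → (joinP α β ==P π) ≡ matchesˡ π α ∧ matchesʳ π β
  ==P-joinP π α β = trans (allFin-+ na nb _) (cong₂ _∧_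
    (allFin-cong na λ k → cong (_==L π (k ↑ˡ nb)) (joinP-↑ˡ α β k))
    (allFin-cong nb λ k → cong (_==L π (na ↑ʳ k)) (joinP-↑ʳ α β k)))

  substP-joinP-↑ˡ : (α : Proj na ma) (β : Proj nb mb) → ∀ j σ →
    substP (joinP α β) (j ↑ˡ mb) σ ≗ joinP (substP α j σ) β
  substP-joinP-↑ˡ α β j σ i with splitAt na i
  ... | inj₁ k rewrite liftL≡renameLit mb (α k) | liftL≡renameLit mb (substLit j σ (α k)) =
    substLit-renameLit (λ {x y} → ↑ˡ-injective mb x y) j σ (α k)
  ... | inj₂ k rewrite liftR≡renameLit ma (β k) =
    substLit-renameLit-apart (j ↑ˡ mb) (λ k′ eq → ↑ˡ≢↑ʳ j k′ (sym eq)) σ (β k)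

  substP-joinP-↑ʳ : (α : Proj na ma) (β : Proj nb mb) → ∀ j σ →
    substP (joinP α β) (ma ↑ʳ j) σ ≗ joinP α (substP β j σ)
  substP-joinP-↑ʳ α β j σ i with splitAt na i
  ... | inj₁ k rewrite liftL≡renameLit mb (α k) =
    substLit-renameLit-apart (ma ↑ʳ j) (λ k′ → ↑ˡ≢↑ʳ k′ j) σ (α k)
  ... | inj₂ k rewrite liftR≡renameLit ma (β k) | liftR≡renameLit ma (substLit j σ (β k)) =
    substLit-renameLit (λ {x y} → ↑ʳ-injective ma x y) j σ (β k)

  fixEvent-joinP-↑ˡ : ∀ π σ k (α : Proj na ma) (β : Proj nb mb) →
    fixEvent π σ (k ↑ˡ nb) (joinP α β) ≡ fixesInto (matchesˡ π) σ k α ∧ matchesʳ π β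
  fixEvent-joinP-↑ˡ π σ k α β = begin
    fixEvent π σ (k ↑ˡ nb) (joinP α β)                  ≡⟨ fixEvent≡fixesInto π σ (k ↑ˡ nb) (joinP α β) ⟩
    maybe fixed false (var (joinP α β (k ↑ˡ nb)))       ≡⟨ cong (maybe fixed false ∘ var) (joinP-↑ˡ α β k) ⟩
    maybe fixed false (var (renameLit (_↑ˡ mb) (α k)))  ≡⟨ split (α k) ⟩
    fixesInto (matchesˡ π) σ k α ∧ matchesʳ π β         ∎
    where
    open ≡-Reasoning
    fixed : Fin (ma ℕ.+ mb) → Bool
    fixed j = substP (joinP α β) j σ ==P π
    fixed-↑ˡ : ∀ j → fixed (j ↑ˡ mb) ≡ matchesˡ π (substP α j σ) ∧ matchesʳ π β
    fixed-↑ˡ j = trans (==P-congˡ π (substP-joinP-↑ˡ α β j σ)) (==P-joinP π (substP α j σ) β)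
    split : ∀ l → maybe fixed false (var (renameLit (_↑ˡ mb) l))
                ≡ maybe (λ j → matchesˡ π (substP α j σ)) false (var l) ∧ matchesʳ π β
    split (const _) = refl
    split (pos j)   = fixed-↑ˡ j
    split (neg j)   = fixed-↑ˡ j

  fixEvent-joinP-↑ʳ : ∀ π σ k (α : Proj na ma) (β : Proj nb mb) →
    fixEvent π σ (na ↑ʳ k) (joinP α β) ≡ matchesˡ π α ∧ fixesInto (matchesʳ π) σ k β
  fixEvent-joinP-↑ʳ π σ k α β = begin
    fixEvent π σ (na ↑ʳ k) (joinP α β)                  ≡⟨ fixEvent≡fixesInto π σ (na ↑ʳ k) (joinP α β) ⟩
    maybe fixed false (var (joinP α β (na ↑ʳ k)))       ≡⟨ cong (maybe fixed false ∘ var) (joinP-↑ʳ α β k) ⟩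
    maybe fixed false (var (renameLit (ma ↑ʳ_) (β k)))  ≡⟨ split (β k) ⟩
    matchesˡ π α ∧ fixesInto (matchesʳ π) σ k β         ∎
    where
    open ≡-Reasoning
    fixed : Fin (ma ℕ.+ mb) → Bool
    fixed j = substP (joinP α β) j σ ==P π
    fixed-↑ʳ : ∀ j → fixed (ma ↑ʳ j) ≡ matchesˡ π α ∧ matchesʳ π (substP β j σ)
    fixed-↑ʳ j = trans (==P-congˡ π (substP-joinP-↑ʳ α β j σ)) (==P-joinP π α (substP β j σ))
    split : ∀ l → maybe fixed false (var (renameLit (ma ↑ʳ_) l))
                ≡ matchesˡ π α ∧ maybe (λ j → matchesʳ π (substP β j σ)) false (var l)
    split (const _) = sym (∧-zeroʳ (matchesˡ π α))
    split (pos j)   = fixed-↑ʳ j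
    split (neg j)   = fixed-↑ʳ j

  Pr-⊎RP : {E : Proj (na ℕ.+ nb) (ma ℕ.+ mb) → Bool} {A : Proj na ma → Bool} {B : Proj nb mb → Bool} →
    (∀ α β → E (joinP α β) ≡ A α ∧ B β) →
    (a : RP na ma) (b : RP nb mb) → Pr (a ⊎RP b) E ≡ Pr a A * Pr b B
  Pr-⊎RP {B = B} E≡A∧B []            b = sym (*-zeroˡ (Pr b B))
  Pr-⊎RP {E} {A} {B} E≡A∧B ((w , α) ∷ a) b = begin
    Pr (row b ++ a ⊎RP b) E                ≡⟨ Pr-++ (row b) (a ⊎RP b) E ⟩
    Pr (row b) E + Pr (a ⊎RP b) E          ≡⟨ cong₂ _+_ (Pr-row b) (Pr-⊎RP E≡A∧B a b) ⟩
    wA * Pr b B + Pr a A * Pr b B          ≡⟨ *-distribʳ-+ (Pr b B) wA (Pr a A) ⟨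
    (wA + Pr a A) * Pr b B                 ∎
    where
    open ≡-Reasoning
    wA : ℚ
    wA = if A α then w else 0ℚ
    row : RP nb mb → RP (na ℕ.+ nb) (ma ℕ.+ mb)
    row = map (λ eb → (w * proj₁ eb , joinP α (proj₂ eb)))
    Pr-row : ∀ b′ → Pr (row b′) E ≡ wA * Pr b′ B
    Pr-row []             = sym (*-zeroʳ wA)
    Pr-row ((v , β) ∷ b′) = begin
      (if E (joinP α β) then w * v else 0ℚ) + Pr (row b′) E
        ≡⟨ cong₂ _+_ (trans (cong (if_then w * v else 0ℚ) (E≡A∧B α β)) (if-∧-* (A α) (B β) w v)) (Pr-row b′) ⟩
      wA * (if B β then v else 0ℚ) + wA * Pr b′ B
        ≡⟨ *-distribˡ-+ wA _ (Pr b′ B) ⟨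
      wA * Pr ((v , β) ∷ b′) B ∎

  ⊎RP-isRandomProjection : {a : RP na ma} {b : RP nb mb} →
    IsRandomProjection a → IsRandomProjection b → IsRandomProjection (a ⊎RP b)
  ⊎RP-isRandomProjection {a} {b} (0≤wa , Σwa≡1) (0≤wb , Σwb≡1) =
    concat⁺ (map⁺ (All.map (λ 0≤w → map⁺ (All.map (*-nonNeg 0≤w) 0≤wb)) 0≤wa)) ,
    (begin
      Pr (a ⊎RP b) always          ≡⟨ Pr-⊎RP {A = always} {always} (λ _ _ → refl) a b ⟩
      Pr a always * Pr b always    ≡⟨ cong₂ _*_ Σwa≡1 Σwb≡1 ⟩
      1ℚ * 1ℚ                      ≡⟨ *-identityˡ 1ℚ ⟩
      1ℚ                           ∎)
    where
    open ≡-Reasoning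
    always : ∀ {n m} → Proj n m → Bool
    always _ = true

  module _ {q₀ q₁ : ℚ} {a : RP na ma} {b : RP nb mb} where
    open ≤-Reasoning

    ⊎RP-fixing-↑ˡ : NonNegWeights b → IsFixing q₀ q₁ a →
      ∀ π σ k → Pr (a ⊎RP b) (fixEvent π σ (k ↑ˡ nb)) ≤ qOf q₀ q₁ σ * Pr (a ⊎RP b) (_==P π)
    ⊎RP-fixing-↑ˡ 0≤wb a-fixing π σ k = begin
      Pr (a ⊎RP b) (fixEvent π σ (k ↑ˡ nb))                  ≡⟨ Pr-⊎RP (fixEvent-joinP-↑ˡ π σ k) a b ⟩
      Pr a (fixesInto (matchesˡ π) σ k) * Pr b (matchesʳ π)   ≤⟨ *-monoʳ-≤-nonNeg (Pr b (matchesʳ π)) {{0≤Prb}} fixed-bound ⟩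
      q * Pr a (matchesˡ π) * Pr b (matchesʳ π)               ≡⟨ *-assoc q _ _ ⟩
      q * (Pr a (matchesˡ π) * Pr b (matchesʳ π))             ≡⟨ cong (q *_) (Pr-⊎RP (==P-joinP π) a b) ⟨
      q * Pr (a ⊎RP b) (_==P π)                               ∎
      where
      q : ℚ
      q = qOf q₀ q₁ σ
      0≤Prb = nonNegative (Pr-nonNeg b (matchesʳ π) 0≤wb)
      fixed-bound : Pr a (fixesInto (matchesˡ π) σ k) ≤ q * Pr a (matchesˡ π)
      fixed-bound = fixesInto-bound {p = a} a-fixing
        (renameP-atMostPoint (λ {x y} → ↑ˡ-injective mb x y) (λ k → π (k ↑ˡ nb))) σ k

    ⊎RP-fixing-↑ʳ : NonNegWeights a → IsFixing q₀ q₁ b →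
      ∀ π σ k → Pr (a ⊎RP b) (fixEvent π σ (na ↑ʳ k)) ≤ qOf q₀ q₁ σ * Pr (a ⊎RP b) (_==P π)
    ⊎RP-fixing-↑ʳ 0≤wa b-fixing π σ k = begin
      Pr (a ⊎RP b) (fixEvent π σ (na ↑ʳ k))                  ≡⟨ Pr-⊎RP (fixEvent-joinP-↑ʳ π σ k) a b ⟩
      Pr a (matchesˡ π) * Pr b (fixesInto (matchesʳ π) σ k)   ≤⟨ *-monoˡ-≤-nonNeg (Pr a (matchesˡ π)) {{0≤Pra}} fixed-bound ⟩
      Pr a (matchesˡ π) * (q * Pr b (matchesʳ π))             ≡⟨ x∙yz≈y∙xz (Pr a (matchesˡ π)) q _ ⟩
      q * (Pr a (matchesˡ π) * Pr b (matchesʳ π))             ≡⟨ cong (q *_) (Pr-⊎RP (==P-joinP π) a b) ⟨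
      q * Pr (a ⊎RP b) (_==P π)                               ∎
      where
      open CommSemigroupProperties (CommutativeMonoid.commutativeSemigroup *-1-commutativeMonoid)
      q : ℚ
      q = qOf q₀ q₁ σ
      0≤Pra = nonNegative (Pr-nonNeg a (matchesˡ π) 0≤wa)
      fixed-bound : Pr b (fixesInto (matchesʳ π) σ k) ≤ q * Pr b (matchesʳ π)
      fixed-bound = fixesInto-bound {p = b} b-fixing
        (renameP-atMostPoint (λ {x y} → ↑ʳ-injective ma x y) (λ k → π (na ↑ʳ k))) σ k

    ⊎RP-fixing : NonNegWeights a → NonNegWeights b → IsFixing q₀ q₁ a → IsFixing q₀ q₁ b →
      IsFixing q₀ q₁ (a ⊎RP b)
    ⊎RP-fixing 0≤wa 0≤wb a-fixing b-fixing π σ i with splitAt na i in eq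
    ... | inj₁ k = subst (λ i → Pr (a ⊎RP b) (fixEvent π σ i) ≤ _)
                         (splitAt⁻¹-↑ˡ eq) (⊎RP-fixing-↑ˡ 0≤wb a-fixing π σ k)
    ... | inj₂ k = subst (λ i → Pr (a ⊎RP b) (fixEvent π σ i) ≤ _)
                         (splitAt⁻¹-↑ʳ eq) (⊎RP-fixing-↑ʳ 0≤wa b-fixing π σ k)

lemma5p2 : (q₀ q₁ : ℚ) {na ma nb mb : ℕ} (a : RP na ma) (b : RP nb mb) →
    IsRandomProjection a → IsFixing q₀ q₁ a →
    IsRandomProjection b → IsFixing q₀ q₁ b →
    IsRandomProjection (a ⊎RP b) × IsFixing q₀ q₁ (a ⊎RP b)
lemma5p2 q₀ q₁ a b a-random a-fixing b-random b-fixing =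
  ⊎RP-isRandomProjection a-random b-random ,
  ⊎RP-fixing (proj₁ a-random) (proj₁ b-random) a-fixing b-fixing
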